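{- Let $n$ and $k$ be positive integers. Then $\operatorname{aw}([n],k) \le \operatorname{aw}([n-1],k) +1$.
   Context: $[m]=\{1,\dots,m\}$ (with $[0]=\emptyset$). A $k$-AP in a set $S$ of integers is a set of $k$ distinct elements of $S$ of the form $a,a+d,\dots,a+(k-1)d$ with $d\ge1$. An $r$-coloring of $S$ is a map $S\to\{1,\dots,r\}$, exact if surjective; a $k$-AP is rainbow if its elements receive $k$ distinct colors. $\operatorname{aw}(S,k)$ is the smallest $r$ such that every exact $r$-coloring of $S$ contains a rainbow $k$-AP; by convention $\operatorname{aw}(S,k)=|S|+1$ if $|S|<k$. -}

module Defs where

open import Data.Nat using (ℕ; zero; suc; _+_; _*_; _∸_; _≤_; _<_)
open import Data.Product using (Σ; _×_; ∃-syntax)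
open import Data.Sum using (_⊎_)
open import Relation.Binary.PropositionalEquality using (_≡_; _≢_)
open import Relation.Nullary using (¬_)

-- [m] = {1,…,m}; a colouring of [m] is any c : ℕ → ℕ (only its values on [m] matter).
-- c is an exact r-colouring of [m]: maps [m] into {1,…,r} and is onto {1,…,r}.
ExactColoring : ℕ → ℕ → (ℕ → ℕ) → Set
ExactColoring m r c =
  (∀ x → 1 ≤ x → x ≤ m → (1 ≤ c x × c x ≤ r)) ×
  (∀ j → 1 ≤ j → j ≤ r → ∃[ x ] (1 ≤ x × x ≤ m × c x ≡ j))

HasRainbowAP : ℕ → ℕ → (ℕ → ℕ) → Set
HasRainbowAP m k c =
  ∃[ a ] ∃[ d ] (1 ≤ d × 1 ≤ a × a + (k ∸ 1) * d ≤ m ×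
    (∀ i j → i < k → j < k → i ≢ j → c (a + i * d) ≢ c (a + j * d)))

Forces : ℕ → ℕ → ℕ → Set
Forces m k r = ∀ c → ExactColoring m r c → HasRainbowAP m k c

-- IsAW m k r : r = aw([m], k)   (r ranges over positive integers;
-- convention aw([m],k) = m+1 when m < k)
IsAW : ℕ → ℕ → ℕ → Set
IsAW m k r =
  (m < k × r ≡ suc m) ⊎
  (k ≤ m × 1 ≤ r × Forces m k r × (∀ s → 1 ≤ s → s < r → ¬ Forces m k s))

module Submission where

-- Write n = m + 1.  The heart of the proof is a colour-merging step: from an
-- exact (b+1)-colouring c of [m+1] we build an exact b-colouring of [m] by
-- sending colour b+1 to the colour e = c(m+1) of the deleted point (or to b
-- when e is b+1 itself).  Every colour ≤ b survives on [m], and since the new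
-- colouring is a function of c, any rainbow k-AP for it is rainbow for c.
-- Hence "b forces a rainbow k-AP in [m]" implies "b+1 forces one in [m+1]".
-- Iterating the same step from [0] gives the pigeonhole fact that [m] has
-- no exact (m+1)-colouring, so the conventional value aw([m],k) = m+1 also
-- forces vacuously in [m+1].  Thus aw([m],k) + 1 always forces a rainbow
-- k-AP in [m+1], and minimality of aw([m+1],k) gives the bound (the case
-- m+1 < k being a direct comparison of the conventional values).

open import Defs
open import Data.Nat using (ℕ; zero; suc; _+_; _∸_; _≤_; _<_; _≟_; _≤?_; z≤n; s≤s)
open import Data.Nat.Properties
  using (≤-refl; ≤-trans; <⇒≢; <-irrefl; ≤∧≢⇒<; m<1+n⇒m≤n; m≤n⇒m≤1+n; n≤1+n; +-comm; ≰⇒>)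
open import Data.Product using (_×_; _,_; ∃-syntax)
open import Data.Sum using (inj₁; inj₂)
open import Data.Empty using (⊥-elim)
open import Function using (_∘_)
open import Relation.Nullary using (¬_; yes; no; contradiction)
open import Relation.Binary.PropositionalEquality using (_≡_; _≢_; refl; sym; trans; cong; subst)

below-top : ∀ {x b} → x ≤ suc b → x ≢ suc b → x ≤ b
below-top x≤ x≢ = m<1+n⇒m≤n (≤∧≢⇒< x≤ x≢)

-- The colour that absorbs the top colour suc b: the colour e of the deleted
-- point, unless e is the top colour itself, in which case b.
absorber : ℕ → ℕ → ℕ
absorber b e with e ≟ suc b
... | yes _ = b
... | no _  = e

merge : ℕ → ℕ → ℕ → ℕ
merge b e j with j ≟ suc b
... | yes _ = absorber b e
... | no _  = j

absorber-other : ∀ b e → e ≢ suc b → absorber b e ≡ e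
absorber-other b e e≢ with e ≟ suc b
... | yes e≡ = contradiction e≡ e≢
... | no _   = refl

merge-top : ∀ b e → merge b e (suc b) ≡ absorber b e
merge-top b e with suc b ≟ suc b
... | yes _ = refl
... | no ne = contradiction refl ne

merge-other : ∀ b e j → j ≢ suc b → merge b e j ≡ j
merge-other b e j j≢ with j ≟ suc b
... | yes j≡ = contradiction j≡ j≢
... | no _   = refl

absorber-range : ∀ b e → 1 ≤ b → 1 ≤ e → e ≤ suc b → 1 ≤ absorber b e × absorber b e ≤ b
absorber-range b e 1≤b 1≤e e≤ with e ≟ suc b
... | yes _ = 1≤b , ≤-refl
... | no e≢ = 1≤e , below-top e≤ e≢

merge-range : ∀ b e j → 1 ≤ b → 1 ≤ e → e ≤ suc b → 1 ≤ j → j ≤ suc b →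
              1 ≤ merge b e j × merge b e j ≤ b
merge-range b e j 1≤b 1≤e e≤ 1≤j j≤ with j ≟ suc b
... | yes _ = absorber-range b e 1≤b 1≤e e≤
... | no j≢ = 1≤j , below-top j≤ j≢

merge-exact : ∀ m b c → 1 ≤ b → ExactColoring (suc m) (suc b) c →
              ExactColoring m b (merge b (c (suc m)) ∘ c)
merge-exact m b c 1≤b (range , onto) = range′ , onto′
  where
  e = c (suc m)

  e-range : 1 ≤ e × e ≤ suc b
  e-range = range (suc m) (s≤s z≤n) ≤-refl

  range′ : ∀ x → 1 ≤ x → x ≤ m → 1 ≤ merge b e (c x) × merge b e (c x) ≤ b
  range′ x 1≤x x≤m with range x 1≤x (m≤n⇒m≤1+n x≤m) | e-range
  ... | 1≤cx , cx≤ | 1≤e , e≤ = merge-range b e (c x) 1≤b 1≤e e≤ 1≤cx cx≤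

  not-deleted : ∀ x → x ≤ suc m → c x ≢ e → x ≤ m
  not-deleted x x≤ cx≢e = below-top x≤ (cx≢e ∘ cong c)

  onto′ : ∀ j → 1 ≤ j → j ≤ b → ∃[ x ] (1 ≤ x × x ≤ m × merge b e (c x) ≡ j)
  onto′ j 1≤j j≤b with j ≟ e
  -- colour j = e is now carried by the points of the old top colour
  ... | yes j≡e with onto (suc b) (s≤s z≤n) ≤-refl
  ...   | x , 1≤x , x≤ , cx≡top =
    x , 1≤x , not-deleted x x≤ (λ cx≡e → j≢top (trans j≡e (trans (sym cx≡e) cx≡top))) ,
    trans (cong (merge b e) cx≡top)
      (trans (merge-top b e) (trans (absorber-other b e (j≢top ∘ trans j≡e)) (sym j≡e)))
    where
    j≢top : j ≢ suc b
    j≢top = <⇒≢ (s≤s j≤b)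
  -- any other colour j is untouched and still used off the deleted point
  onto′ j 1≤j j≤b | no j≢e with onto j 1≤j (m≤n⇒m≤1+n j≤b)
  ...   | x , 1≤x , x≤ , cx≡j =
    x , 1≤x , not-deleted x x≤ (j≢e ∘ trans (sym cx≡j)) ,
    trans (cong (merge b e) cx≡j) (merge-other b e j (<⇒≢ (s≤s j≤b)))

rainbow-reflect : ∀ {m m′ k} c (f : ℕ → ℕ) → m ≤ m′ → HasRainbowAP m k (f ∘ c) → HasRainbowAP m′ k c
rainbow-reflect c f m≤m′ (a , d , 1≤d , 1≤a , end≤m , distinct) =
  a , d , 1≤d , 1≤a , ≤-trans end≤m m≤m′ ,
  λ i j i<k j<k i≢j same → distinct i j i<k j<k i≢j (cong f same)

no-exact-overcolouring : ∀ m c → ¬ ExactColoring m (suc m) c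
no-exact-overcolouring zero c (_ , onto) with onto 1 ≤-refl ≤-refl
... | x , 1≤x , x≤0 , _ = <-irrefl refl (≤-trans 1≤x x≤0)
no-exact-overcolouring (suc m) c exact =
  no-exact-overcolouring m _ (merge-exact m (suc m) c (s≤s z≤n) exact)

forces-step : ∀ m k b → 1 ≤ b → Forces m k b → Forces (suc m) k (suc b)
forces-step m k b 1≤b forces c exact =
  rainbow-reflect c (merge b (c (suc m))) (n≤1+n m)
    (forces _ (merge-exact m b c 1≤b exact))

-- aw([m],k) + 1 colours always force a rainbow k-AP in [m + 1]; in the
-- conventional case aw([m],k) = m + 1 this holds vacuously by pigeonhole.
aw-successor-forces : ∀ m k b → IsAW m k b → Forces (suc m) k (suc b)
aw-successor-forces m k b (inj₁ (_ , refl)) c exact = ⊥-elim (no-exact-overcolouring (suc m) c exact)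
aw-successor-forces m k b (inj₂ (_ , 1≤b , forces , _)) = forces-step m k b 1≤b forces

aw-conventional : ∀ {m k b} → m < k → IsAW m k b → b ≡ suc m
aw-conventional _   (inj₁ (_ , b≡))  = b≡
aw-conventional m<k (inj₂ (k≤m , _)) = contradiction (≤-trans m<k k≤m) (<-irrefl refl)

least-below : ∀ {m k a} s → (∀ t → 1 ≤ t → t < a → ¬ Forces m k t) →
              1 ≤ s → Forces m k s → a ≤ s
least-below {a = a} s least 1≤s forces with a ≤? s
... | yes a≤s = a≤s
... | no a≰s  = contradiction forces (least s 1≤s (≰⇒> a≰s))

proposition2p15 : ∀ (n k : ℕ) → 1 ≤ n → 1 ≤ k →
    ∀ (a b : ℕ) → IsAW n k a → IsAW (n ∸ 1) k b → a ≤ b + 1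
proposition2p15 (suc m) k _ _ a b awₙ awₘ = subst (a ≤_) (+-comm 1 b) (bound awₙ)
  where
  bound : IsAW (suc m) k a → a ≤ suc b
  bound (inj₁ (n<k , refl)) rewrite aw-conventional (≤-trans (n≤1+n (suc m)) n<k) awₘ = ≤-refl
  -- k ≤ n: a is least among forcing numbers and b + 1 forces
  bound (inj₂ (_ , _ , _ , least)) = least-below (suc b) least (s≤s z≤n) (aw-successor-forces m k b awₘ)
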